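{- Let $\sigma = \{\mathit{atom}, \mathit{rule}, h, b, b^{\neg}, b^{\mathbf{not}}, b^{\mathbf{not}\neg}, b^{\neg\mathbf{not}}, b^{\neg\mathbf{not}\neg}\}$ be the signature described in the context. There is a fixed MSO sentence $\phi$ over $\sigma$ such that for every ground epistemic logic program $\Pi$, $\Pi$ has a world view if and only if $\mathfrak{P}_\Pi \models \phi$, where $\mathfrak{P}_\Pi$ is the $\sigma$-structure representing $\Pi$.
   Context: A ground epistemic logic program (ELP) is a pair $\Pi=(\mathcal{A},\mathcal{R})$ with $\mathcal{A}$ a finite set of propositional atoms and $\mathcal{R}$ a finite set of rules $a_1\vee\cdots\vee a_k \leftarrow \ell_1,\dots,\ell_m,\xi_1,\dots,\xi_j,\neg\xi_{j+1},\dots,\neg\xi_n$, where the $a_i\in\mathcal{A}$, each $\ell_i$ is a literal ($a$ or $\neg a$, $a\in\mathcal{A}$, $\neg$ being default negation), and each $\xi_i$ is an epistemic literal $\mathbf{not}\,\ell$ with $\ell$ a literal over $\mathcal{A}$. Semantics. A (plain) logic program is a program of this form without epistemic literals, where body elements may be atoms $a$ or $\neg\ell$ with $\ell$ a literal (so $\neg\neg a$ may occur; $\neg\neg\neg a$ is treated as $\neg a$). For an interpretation $I\subseteq\mathcal{A}$: $I\models a$ iff $a\in I$, $I\models\neg\ell$ iff $I\not\models\ell$; $I$ is a model of a rule if whenever $I$ satisfies all body elements, some head atom is in $I$; a model of a program is a model of all its rules. The GL-reduct $\mathscr{P}^M$ of a logic program w.r.t. $M$ keeps, for each rule $r$ such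 that $M\not\models\ell$ for every body element $\neg\ell$ of $r$, the rule $\mathrm{head}(r)\leftarrow\mathrm{body}^+(r)$ (the positive atoms of the body), and drops the others. $M$ is an answer set of $\mathscr{P}$ if $M$ is a model of $\mathscr{P}$ and no $M'\subsetneq M$ is a model of $\mathscr{P}^M$. A candidate world interpretation (CWI) is a consistent set $I$ of literals over $\mathcal{A}$, viewed as a three-partition $I^P=I\cap\mathcal{A}$, $I^N=\{a\mid\neg a\in I\}$, $I^U=\mathcal{A}\setminus(I^P\cup I^N)$. $I$ is compatible with a set $\mathcal{I}$ of interpretations if (1) $\mathcal{I}\neq\emptyset$; (2) every $a\in I^P$ belongs to every $J\in\mathcal{I}$; (3) no $a\in I^N$ belongs to any $J\in\mathcal{I}$; (4) for each $a\in I^U$ there are $J,J'\in\mathcal{I}$ with $a\in J$, $a\notin J'$. The epistemic reduct $\Pi^I$ is the logic program obtained by replacing in each rule every epistemic literal $\mathbf{not}\,\ell$ by $\neg\ell$ if $\ell\in I$ and by $\top$ otherwise. $I$ is a candidate world view (CWV) if it is compatible with the set of answer sets of $\Pi^I$; a world view (WV) is a CWV $I$ such that no $J\subsetneq I$ is a CWV. The $\sigma$-structure $\mathfrak{P}_\Pi$ has domain $\mathcal{A}\cup\mathcal{R}$, with $\mathit{atom}(a)$ for each atom $a$, $\mathit{rule}(r)$ for each rule $r$, $h(a,r)$ iff $a$ is in the head of $r$, and $b^{\square}(a,r)$ for $\square\in\{\epsilon,\neg,\mathbf{not},\mathbf{not}\neg,\neg\mathbf{not},\neg\mathbf{not}\neg\}$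 ($\epsilon$ the empty word, $b^\epsilon=b$) iff the body of $r$ contains the element $\square a$ (e.g. $b^{\neg\mathbf{not}\neg}(a,r)$ iff $\neg\,\mathbf{not}\,\neg a$ occurs in the body of $r$). -}

module Defs where

open import Data.Nat using (ℕ; _+_)
open import Data.Fin using (Fin; splitAt)
open import Data.Bool using (Bool; true; false)
open import Data.List using (List; map)
open import Data.List.Relation.Unary.All using (All)
open import Data.List.Relation.Unary.Any using (Any)
open import Data.List.Membership.Propositional using (_∈_)
open import Data.Sum using (_⊎_; inj₁; inj₂)
open import Data.Product using (Σ; _×_; ∃)
open import Data.Unit using (⊤)
open import Data.Empty using (⊥)
open import Relation.Nullary using (¬_)
open import Relation.Binary.PropositionalEquality using (_≡_; _≢_)

data Lit (n : ℕ) : Set where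
  pos : Fin n → Lit n
  neg : Fin n → Lit n

data BodyElem (n : ℕ) : Set where
  b-ε       : Fin n → BodyElem n
  b-¬       : Fin n → BodyElem n
  b-not     : Fin n → BodyElem n
  b-not¬    : Fin n → BodyElem n
  b-¬not    : Fin n → BodyElem n
  b-¬not¬   : Fin n → BodyElem n

record ERule (n : ℕ) : Set where
  constructor erule
  field
    head : List (Fin n)
    body : List (BodyElem n)

record ELP : Set where
  field
    nA : ℕ
    nR : ℕ
    rules : Fin nR → ERule nA

-- body elements of a plain program: a, ¬ℓ (ℓ a literal), and the
-- constants ⊤ and ¬⊤ that arise from the epistemic reduct
data PElem (n : ℕ) : Set where
  atm  : Fin n → PElem n
  nlit : Lit n → PElem n
  top  : PElem n
  ntop : PElem n

record PRule (n : ℕ) : Set where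
  constructor prule
  field
    head : List (Fin n)
    body : List (PElem n)

LP : ℕ → ℕ → Set
LP n k = Fin k → PRule n

Interp : ℕ → Set
Interp n = Fin n → Bool

_⊨L_ : ∀ {n} → Interp n → Lit n → Set
I ⊨L pos a = I a ≡ true
I ⊨L neg a = ¬ (I ⊨L pos a)

_⊨E_ : ∀ {n} → Interp n → PElem n → Set
I ⊨E atm a  = I a ≡ true
I ⊨E nlit ℓ = ¬ (I ⊨L ℓ)
I ⊨E top    = ⊤
I ⊨E ntop   = ¬ ⊤

ModelRule : ∀ {n} → Interp n → PRule n → Set
ModelRule I r = All (I ⊨E_) (PRule.body r) → Any (λ a → I a ≡ true) (PRule.head r)

Model : ∀ {n k} → Interp n → LP n k → Set
Model I P = ∀ r → ModelRule I (P r)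

-- GL-reduct: a rule is kept iff M ⊭ ℓ for every body element ¬ℓ
KeepOK : ∀ {n} → Interp n → PElem n → Set
KeepOK M (atm a)  = ⊤
KeepOK M (nlit ℓ) = ¬ (M ⊨L ℓ)
KeepOK M top      = ⊤
KeepOK M ntop     = ¬ (M ⊨E top)

Kept : ∀ {n} → Interp n → PRule n → Set
Kept M r = All (KeepOK M) (PRule.body r)

BodyPos : ∀ {n} → List (PElem n) → Fin n → Set
BodyPos b a = atm a ∈ b

ModelPosRule : ∀ {n} → Interp n → PRule n → Set
ModelPosRule I r =
  (∀ a → BodyPos (PRule.body r) a → I a ≡ true) → Any (λ a → I a ≡ true) (PRule.head r)

ModelReduct : ∀ {n k} → LP n k → Interp n → Interp n → Set
ModelReduct P M I = ∀ r → Kept M (P r) → ModelPosRule I (P r)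

_⊊_ : ∀ {n} → Interp n → Interp n → Set
M' ⊊ M = (∀ a → M' a ≡ true → M a ≡ true) × ∃ λ a → (M a ≡ true) × (M' a ≡ false)

AnswerSet : ∀ {n k} → LP n k → Interp n → Set
AnswerSet P M = Model M P × (∀ M' → M' ⊊ M → ¬ ModelReduct P M M')

-- Candidate world interpretations (consistent sets of literals)

data Three : Set where
  tP tN tU : Three     -- a ∈ I, ¬a ∈ I, neither

CWI : ℕ → Set
CWI n = Fin n → Three

_⊊ᴵ_ : ∀ {n} → CWI n → CWI n → Set
J ⊊ᴵ I = (∀ a → J a ≢ tU → J a ≡ I a) × ∃ λ a → J a ≢ I a

Compatible : ∀ {n} → CWI n → (Interp n → Set) → Set
Compatible {n} I 𝓘 =
  (∃ λ J → 𝓘 J)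
  × (∀ a → I a ≡ tP → ∀ J → 𝓘 J → J a ≡ true)
  × (∀ a → I a ≡ tN → ∀ J → 𝓘 J → J a ≡ false)
  × (∀ a → I a ≡ tU → ∃ λ J → ∃ λ J' → 𝓘 J × 𝓘 J' × J a ≡ true × J' a ≡ false)

-- epistemic reduct: not ℓ ↦ ¬ℓ if ℓ ∈ I, ⊤ otherwise
-- (¬¬¬a is treated as ¬a)
reductElem : ∀ {n} → CWI n → BodyElem n → PElem n
reductElem I (b-ε a) = atm a
reductElem I (b-¬ a) = nlit (pos a)
reductElem I (b-not a) with I a
... | tP = nlit (pos a)
... | tN = top
... | tU = top
reductElem I (b-not¬ a) with I a
... | tN = nlit (neg a)
... | tP = top
... | tU = top
reductElem I (b-¬not a) with I a
... | tP = nlit (neg a)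
... | tN = ntop
... | tU = ntop
reductElem I (b-¬not¬ a) with I a
... | tN = nlit (pos a)
... | tP = ntop
... | tU = ntop

epiReduct : (Π : ELP) → CWI (ELP.nA Π) → LP (ELP.nA Π) (ELP.nR Π)
epiReduct Π I r = prule (ERule.head (ELP.rules Π r)) (map (reductElem I) (ERule.body (ELP.rules Π r)))

CWV : (Π : ELP) → CWI (ELP.nA Π) → Set
CWV Π I = Compatible I (AnswerSet (epiReduct Π I))

WV : (Π : ELP) → CWI (ELP.nA Π) → Set
WV Π I = CWV Π I × (∀ J → J ⊊ᴵ I → ¬ CWV Π J)

HasWorldView : ELP → Set
HasWorldView Π = ∃ λ I → WV Π I

data USym : Set where
  atomS ruleS : USym

data BSym : Set where
  hS bS b¬S bnotS bnot¬S b¬notS b¬not¬S : BSym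

record σStructure : Set₁ where
  field
    dom  : ℕ
    uRel : USym → Fin dom → Set
    bRel : BSym → Fin dom → Fin dom → Set

-- MSO formulas with k first-order and m (monadic) second-order
-- variables in scope (de Bruijn indices)
data Formula (k m : ℕ) : Set where
  rel₁  : USym → Fin k → Formula k m
  rel₂  : BSym → Fin k → Fin k → Formula k m
  _≐_   : Fin k → Fin k → Formula k m
  _∈̇_   : Fin k → Fin m → Formula k m
  ⊥̇     : Formula k m
  ¬̇_    : Formula k m → Formula k m
  _∧̇_ _∨̇_ _⇒̇_ : Formula k m → Formula k m → Formula k m
  ∃₁ ∀₁ : Formula (ℕ.suc k) m → Formula k m
  ∃₂ ∀₂ : Formula k (ℕ.suc m) → Formula k m

Sentence : Set
Sentence = Formula 0 0

extend : ∀ {k} {A : Set} → A → (Fin k → A) → Fin (ℕ.suc k) → A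
extend x ρ Fin.zero = x
extend x ρ (Fin.suc i) = ρ i

Sat : (𝔄 : σStructure) → ∀ {k m} →
      (Fin k → Fin (σStructure.dom 𝔄)) →
      (Fin m → (Fin (σStructure.dom 𝔄) → Bool)) →
      Formula k m → Set
Sat 𝔄 ρ η (rel₁ s x)   = σStructure.uRel 𝔄 s (ρ x)
Sat 𝔄 ρ η (rel₂ s x y) = σStructure.bRel 𝔄 s (ρ x) (ρ y)
Sat 𝔄 ρ η (x ≐ y)      = ρ x ≡ ρ y
Sat 𝔄 ρ η (x ∈̇ X)      = η X (ρ x) ≡ true
Sat 𝔄 ρ η ⊥̇            = ⊥
Sat 𝔄 ρ η (¬̇ φ)        = ¬ Sat 𝔄 ρ η φ
Sat 𝔄 ρ η (φ ∧̇ ψ)      = Sat 𝔄 ρ η φ × Sat 𝔄 ρ η ψ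
Sat 𝔄 ρ η (φ ∨̇ ψ)      = Sat 𝔄 ρ η φ ⊎ Sat 𝔄 ρ η ψ
Sat 𝔄 ρ η (φ ⇒̇ ψ)      = Sat 𝔄 ρ η φ → Sat 𝔄 ρ η ψ
Sat 𝔄 ρ η (∃₁ φ)       = ∃ λ x → Sat 𝔄 (extend x ρ) η φ
Sat 𝔄 ρ η (∀₁ φ)       = ∀ x → Sat 𝔄 (extend x ρ) η φ
Sat 𝔄 ρ η (∃₂ φ)       = ∃ λ X → Sat 𝔄 ρ (extend X η) φ
Sat 𝔄 ρ η (∀₂ φ)       = ∀ X → Sat 𝔄 ρ (extend X η) φ

_⊨_ : σStructure → Sentence → Set
𝔄 ⊨ φ = Sat 𝔄 (λ ()) (λ ()) φ

-- The σ-structure 𝔓_Π : domain A ⊎ R encoded as Fin (nA + nR)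

module _ (Π : ELP) where
  open ELP Π

  private
    uRel' : USym → Fin nA ⊎ Fin nR → Set
    uRel' atomS (inj₁ _) = ⊤
    uRel' atomS (inj₂ _) = ⊥
    uRel' ruleS (inj₁ _) = ⊥
    uRel' ruleS (inj₂ _) = ⊤

    elemOf : BSym → Fin nA → BodyElem nA
    elemOf hS      a = b-ε a   -- unused
    elemOf bS      a = b-ε a
    elemOf b¬S     a = b-¬ a
    elemOf bnotS   a = b-not a
    elemOf bnot¬S  a = b-not¬ a
    elemOf b¬notS  a = b-¬not a
    elemOf b¬not¬S a = b-¬not¬ a

    bRel' : BSym → Fin nA ⊎ Fin nR → Fin nA ⊎ Fin nR → Set
    bRel' hS (inj₁ a) (inj₂ r) = a ∈ ERule.head (rules r)
    bRel' bS (inj₁ a) (inj₂ r) = elemOf bS a ∈ ERule.body (rules r)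
    bRel' b¬S (inj₁ a) (inj₂ r) = elemOf b¬S a ∈ ERule.body (rules r)
    bRel' bnotS (inj₁ a) (inj₂ r) = elemOf bnotS a ∈ ERule.body (rules r)
    bRel' bnot¬S (inj₁ a) (inj₂ r) = elemOf bnot¬S a ∈ ERule.body (rules r)
    bRel' b¬notS (inj₁ a) (inj₂ r) = elemOf b¬notS a ∈ ERule.body (rules r)
    bRel' b¬not¬S (inj₁ a) (inj₂ r) = elemOf b¬not¬S a ∈ ERule.body (rules r)
    bRel' _ _ _ = ⊥

  𝔓 : σStructure
  𝔓 = record
    { dom  = nA + nR
    ; uRel = λ s x → uRel' s (splitAt nA x)
    ; bRel = λ s x y → bRel' s (splitAt nA x) (splitAt nA y)
    }

module Submission where

-- A world view is guessed as two disjoint monadic predicates P and N on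
-- atoms (the atoms true, resp. false, in I), answer sets and their
-- proper subsets as further monadic predicates. The epistemic reduct
-- never has to be built: whether the reduct of a body element holds in M,
-- or keeps its rule in the GL-reduct, is a quantifier-free condition on
-- the membership of its atom in P, N and M. Compatibility and the two
-- minimality conditions (of answer sets and of world views) are then
-- plain second-order quantifications.

open import Defs
open import Data.Bool using (Bool; true; false)
open import Data.Bool.Properties using (¬-not; not-¬)
open import Data.Empty using (⊥-elim)
open import Data.Fin using (Fin; zero; suc; splitAt; _↑ˡ_; _↑ʳ_; join)
open import Data.Fin.Properties using (splitAt-↑ˡ; splitAt-↑ʳ; join-splitAt)
open import Data.List using (List; map)
open import Data.List.Membership.Propositional using (_∈_; find; lose)
open import Data.List.Membership.Propositional.Properties using (∈-map⁺; ∈-map⁻)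
open import Data.List.Relation.Unary.All using (All; tabulate) renaming (lookup to All-lookup)
open import Data.List.Relation.Unary.All.Properties using (map⁺; map⁻)
open import Data.List.Relation.Unary.Any using (Any)
open import Data.Nat using (ℕ; suc; _+_)
open import Data.Product using (Σ; _×_; _,_; proj₂; ∃)
open import Data.Product.Function.NonDependent.Propositional using (_×-⇔_)
open import Data.Sum using (inj₁; inj₂; [_,_]′)
open import Data.Unit using (tt)
open import Function.Base using (_∘_; id; case_of_)
open import Function.Bundles using (_⇔_; mk⇔; Equivalence)
open import Function.Related.TypeIsomorphisms using (→-cong-⇔; ¬-cong-⇔)
import Function.Properties.Equivalence as ⇔
open import Relation.Nullary using (¬_)
open import Relation.Binary.PropositionalEquality using (_≡_; _≢_; refl; sym; trans; cong; subst; subst₂)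

open Equivalence using (to; from)

variable
  k m n : ℕ

Π-cong-⇔ : {A : Set} {B C : A → Set} → (∀ x → B x ⇔ C x) → (∀ x → B x) ⇔ (∀ x → C x)
Π-cong-⇔ B⇔C = mk⇔ (λ f x → to (B⇔C x) (f x)) (λ g x → from (B⇔C x) (g x))

≡true-cong : {b b′ : Bool} → b ≡ b′ → (b ≡ true) ⇔ (b′ ≡ true)
≡true-cong refl = ⇔.refl

≢true⇔≡false : ∀ {b} → (b ≢ true) ⇔ (b ≡ false)
≢true⇔≡false = mk⇔ ¬-not not-¬

All-map⇔ : {A B : Set} {P : B → Set} {f : A → B} {xs : List A} →
           All P (map f xs) ⇔ (∀ x → x ∈ xs → P (f x))
All-map⇔ = mk⇔ (λ ps x → All-lookup (map⁻ ps)) (λ g → map⁺ (tabulate (g _)))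

-- Three-valued atoms as pairs of bits

data Code : Three → Bool → Bool → Set where
  tP-code : Code tP true false
  tN-code : Code tN false true
  tU-code : Code tU false false

inP inN : Three → Bool
inP tP = true
inP _  = false
inN tN = true
inN _  = false

code : ∀ t → Code t (inP t) (inN t)
code tP = tP-code
code tN = tN-code
code tU = tU-code

three : Bool → Bool → Three
three true  _     = tP
three false true  = tN
three false false = tU

code-three : ∀ p q → ¬ (p ≡ true × q ≡ true) → Code (three p q) p q
code-three true  true  p∧q = ⊥-elim (p∧q (refl , refl))
code-three true  false _   = tP-code
code-three false true  _   = tN-code
code-three false false _   = tU-code

code-disjoint : ∀ {t p q} → Code t p q → ¬ (p ≡ true × q ≡ true)
code-disjoint tP-code (_ , ())
code-disjoint tN-code (() , _)
code-disjoint tU-code (() , _)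

code-tP : ∀ {t p q} → Code t p q → (p ≡ true) ⇔ (t ≡ tP)
code-tP tP-code = mk⇔ (λ _ → refl) (λ _ → refl)
code-tP tN-code = mk⇔ (λ ()) (λ ())
code-tP tU-code = mk⇔ (λ ()) (λ ())

code-tN : ∀ {t p q} → Code t p q → (q ≡ true) ⇔ (t ≡ tN)
code-tN tP-code = mk⇔ (λ ()) (λ ())
code-tN tN-code = mk⇔ (λ _ → refl) (λ _ → refl)
code-tN tU-code = mk⇔ (λ ()) (λ ())

code-tU : ∀ {t p q} → Code t p q → (p ≢ true × q ≢ true) ⇔ (t ≡ tU)
code-tU tP-code = mk⇔ (λ (p≢ , _) → ⊥-elim (p≢ refl)) (λ ())
code-tU tN-code = mk⇔ (λ (_ , q≢) → ⊥-elim (q≢ refl)) (λ ())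
code-tU tU-code = mk⇔ (λ _ → refl) (λ _ → (λ ()) , (λ ()))

Iff : Set → Set → Set
Iff A B = (A → B) × (B → A)

code-≡ : ∀ {t p q t′ p′ q′} → Code t p q → Code t′ p′ q′ →
         (Iff (p ≡ true) (p′ ≡ true) × Iff (q ≡ true) (q′ ≡ true)) ⇔ (t ≡ t′)
code-≡ tP-code tP-code = mk⇔ (λ _ → refl) (λ _ → (id , id) , (id , id))
code-≡ tN-code tN-code = mk⇔ (λ _ → refl) (λ _ → (id , id) , (id , id))
code-≡ tU-code tU-code = mk⇔ (λ _ → refl) (λ _ → (id , id) , (id , id))
code-≡ tP-code tN-code = mk⇔ (λ ((p→p′ , _) , _) → case p→p′ refl of λ ()) (λ ())
code-≡ tP-code tU-code = mk⇔ (λ ((p→p′ , _) , _) → case p→p′ refl of λ ()) (λ ())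
code-≡ tN-code tP-code = mk⇔ (λ ((_ , p′→p) , _) → case p′→p refl of λ ()) (λ ())
code-≡ tN-code tU-code = mk⇔ (λ (_ , (q→q′ , _)) → case q→q′ refl of λ ()) (λ ())
code-≡ tU-code tP-code = mk⇔ (λ ((_ , p′→p) , _) → case p′→p refl of λ ()) (λ ())
code-≡ tU-code tN-code = mk⇔ (λ (_ , (_ , q′→q)) → case q′→q refl of λ ()) (λ ())

code-⊑ : ∀ {t p q t′ p′ q′} → Code t p q → Code t′ p′ q′ →
         ((p ≡ true → p′ ≡ true) × (q ≡ true → q′ ≡ true)) ⇔ (t ≢ tU → t ≡ t′)
code-⊑ tU-code _       = mk⇔ (λ _ t≢tU → ⊥-elim (t≢tU refl)) (λ _ → (λ ()) , (λ ()))
code-⊑ tP-code tP-code = mk⇔ (λ _ _ → refl) (λ _ → id , id)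
code-⊑ tP-code tN-code = mk⇔ (λ (p→p′ , _) → case p→p′ refl of λ ()) (λ t≡t′ → case t≡t′ (λ ()) of λ ())
code-⊑ tP-code tU-code = mk⇔ (λ (p→p′ , _) → case p→p′ refl of λ ()) (λ t≡t′ → case t≡t′ (λ ()) of λ ())
code-⊑ tN-code tN-code = mk⇔ (λ _ _ → refl) (λ _ → id , id)
code-⊑ tN-code tP-code = mk⇔ (λ (_ , q→q′) → case q→q′ refl of λ ()) (λ t≡t′ → case t≡t′ (λ ()) of λ ())
code-⊑ tN-code tU-code = mk⇔ (λ (_ , q→q′) → case q→q′ refl of λ ()) (λ t≡t′ → case t≡t′ (λ ()) of λ ())

_⇔̇_ : Formula k m → Formula k m → Formula k m
φ ⇔̇ ψ = (φ ⇒̇ ψ) ∧̇ (ψ ⇒̇ φ)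

∀ᵃ ∃ᵃ ∀ʳ : Formula (suc k) m → Formula k m
∀ᵃ φ = ∀₁ (rel₁ atomS zero ⇒̇ φ)
∃ᵃ φ = ∃₁ (rel₁ atomS zero ∧̇ φ)
∀ʳ φ = ∀₁ (rel₁ ruleS zero ⇒̇ φ)

∀[_∙_]_ : BSym → Fin k → Formula (suc k) m → Formula k m
∀[ s ∙ v ] φ = ∀₁ (rel₂ s zero (suc v) ⇒̇ φ)

data BodyKind : Set where
  kε k¬ knot knot¬ k¬not k¬not¬ : BodyKind

bodySym : BodyKind → BSym
bodySym kε     = bS
bodySym k¬     = b¬S
bodySym knot   = bnotS
bodySym knot¬  = bnot¬S
bodySym k¬not  = b¬notS
bodySym k¬not¬ = b¬not¬S

bodyElem : BodyKind → Fin n → BodyElem n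
bodyElem kε     = b-ε
bodyElem k¬     = b-¬
bodyElem knot   = b-not
bodyElem knot¬  = b-not¬
bodyElem k¬not  = b-¬not
bodyElem k¬not¬ = b-¬not¬

∀-bodyElem : {R : BodyElem n → Set} → (∀ c a → R (bodyElem c a)) ⇔ (∀ e → R e)
∀-bodyElem = mk⇔ to′ (λ f c a → f (bodyElem c a))
  where
  to′ : ∀ {R : BodyElem n → Set} → (∀ c a → R (bodyElem c a)) → ∀ e → R e
  to′ f (b-ε a)     = f kε a
  to′ f (b-¬ a)     = f k¬ a
  to′ f (b-not a)   = f knot a
  to′ f (b-not¬ a)  = f knot¬ a
  to′ f (b-¬not a)  = f k¬not a
  to′ f (b-¬not¬ a) = f k¬not¬ a

⋀ᵇ : (BodyKind → Formula k m) → Formula k m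
⋀ᵇ φ = φ kε ∧̇ (φ k¬ ∧̇ (φ knot ∧̇ (φ knot¬ ∧̇ (φ k¬not ∧̇ φ k¬not¬))))

-- Variable zero is an atom a; P, N, M hold the sets I^P, I^N and a
-- candidate answer set. The reduct of  not ℓ  is ¬ℓ when ℓ ∈ I and ⊤
-- otherwise, and that of  ¬ not ℓ  is ¬¬ℓ when ℓ ∈ I and ¬⊤ otherwise.
elemF : Fin m → Fin m → Fin m → BodyKind → Formula (suc k) m
elemF P N M kε     = zero ∈̇ M
elemF P N M k¬     = ¬̇ (zero ∈̇ M)
elemF P N M knot   = (zero ∈̇ P) ⇒̇ (¬̇ (zero ∈̇ M))
elemF P N M knot¬  = (zero ∈̇ N) ⇒̇ (¬̇ (¬̇ (zero ∈̇ M)))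
elemF P N M k¬not  = (zero ∈̇ P) ∧̇ (¬̇ (¬̇ (zero ∈̇ M)))
elemF P N M k¬not¬ = (zero ∈̇ N) ∧̇ (¬̇ (zero ∈̇ M))

-- The GL-reduct moves positive atoms to body⁺ and keeps a rule iff every
-- other reduct element (¬ℓ, ⊤ or ¬⊤) holds in M.
keptF : Fin m → Fin m → Fin m → BodyKind → Formula (suc k) m
keptF P N M kε = ¬̇ ⊥̇
keptF P N M c  = elemF P N M c

bodyF : (BodyKind → Formula (suc k) m) → Fin k → Formula k m
bodyF φ r = ⋀ᵇ (λ c → ∀[ bodySym c ∙ r ] φ c)

headF : Fin m → Fin k → Formula k m
headF M r = ∃₁ (rel₂ hS zero (suc r) ∧̇ (zero ∈̇ M))

positiveBodyF : Fin m → Fin k → Formula k m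
positiveBodyF M r = ∀[ bS ∙ r ] (zero ∈̇ M)

modelF : Fin m → Fin m → Fin m → Formula k m
modelF P N M = ∀ʳ (bodyF (elemF P N M) zero ⇒̇ headF M zero)

reductModelF : Fin m → Fin m → Fin m → Fin m → Formula k m
reductModelF P N M M′ =
  ∀ʳ (bodyF (keptF P N M) zero ⇒̇ (positiveBodyF M′ zero ⇒̇ headF M′ zero))

⊊F : Fin m → Fin m → Formula k m
⊊F M′ M = ∀ᵃ ((zero ∈̇ M′) ⇒̇ (zero ∈̇ M)) ∧̇ ∃ᵃ ((zero ∈̇ M) ∧̇ (¬̇ (zero ∈̇ M′)))

answerSetF : Fin m → Fin m → Fin m → Formula k m
answerSetF P N M =
  modelF P N M ∧̇ ∀₂ (⊊F zero (suc M) ⇒̇ (¬̇ reductModelF (suc P) (suc N) (suc M) zero))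

someAnswerSetF : Fin m → Fin m → Formula k m
someAnswerSetF P N = ∃₂ (answerSetF (suc P) (suc N) zero)

positiveF negativeF undefinedF : Fin m → Fin m → Formula k m
positiveF P N =
  ∀ᵃ ((zero ∈̇ P) ⇒̇ ∀₂ (answerSetF (suc P) (suc N) zero ⇒̇ (zero ∈̇ zero)))
negativeF P N =
  ∀ᵃ ((zero ∈̇ N) ⇒̇ ∀₂ (answerSetF (suc P) (suc N) zero ⇒̇ (¬̇ (zero ∈̇ zero))))
undefinedF P N =
  ∀ᵃ (((¬̇ (zero ∈̇ P)) ∧̇ (¬̇ (zero ∈̇ N))) ⇒̇
      ∃₂ (∃₂ (answerSetF (suc (suc P)) (suc (suc N)) (suc zero)
          ∧̇ (answerSetF (suc (suc P)) (suc (suc N)) zero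
          ∧̇ ((zero ∈̇ suc zero) ∧̇ (¬̇ (zero ∈̇ zero)))))))

candidateWorldViewF : Fin m → Fin m → Formula k m
candidateWorldViewF P N =
  someAnswerSetF P N ∧̇ (positiveF P N ∧̇ (negativeF P N ∧̇ undefinedF P N))

disjointF : Fin m → Fin m → Formula k m
disjointF X Y = ∀₁ (¬̇ ((zero ∈̇ X) ∧̇ (zero ∈̇ Y)))

∀ᶜ ∃ᶜ : Formula k (suc (suc m)) → Formula k m
∀ᶜ φ = ∀₂ (∀₂ (disjointF (suc zero) zero ⇒̇ φ))
∃ᶜ φ = ∃₂ (∃₂ (disjointF (suc zero) zero ∧̇ φ))

⊊ᶜF : Fin m → Fin m → Fin m → Fin m → Formula k m
⊊ᶜF P′ N′ P N =
  ∀ᵃ (((zero ∈̇ P′) ⇒̇ (zero ∈̇ P)) ∧̇ ((zero ∈̇ N′) ⇒̇ (zero ∈̇ N)))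
  ∧̇ ∃ᵃ (¬̇ (((zero ∈̇ P′) ⇔̇ (zero ∈̇ P)) ∧̇ ((zero ∈̇ N′) ⇔̇ (zero ∈̇ N))))

worldViewF : Fin m → Fin m → Formula k m
worldViewF P N =
  candidateWorldViewF P N
  ∧̇ ∀ᶜ (⊊ᶜF (suc zero) zero (suc (suc P)) (suc (suc N)) ⇒̇ (¬̇ candidateWorldViewF (suc zero) zero))

hasWorldViewF : Sentence
hasWorldViewF = ∃ᶜ (worldViewF (suc zero) zero)

-- A record rather than  Sat 𝔄 ρ η φ ⇔ A : record types are injective,
-- so ρ, η and φ are inferred at use sites, whereas Sat computes on φ.
record Expresses (𝔄 : σStructure) {k m} (ρ : Fin k → Fin (σStructure.dom 𝔄))
                 (η : Fin m → Fin (σStructure.dom 𝔄) → Bool) (φ : Formula k m) (A : Set) : Set where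
  constructor expresses
  field sat⇔ : Sat 𝔄 ρ η φ ⇔ A

open Expresses

module _ {𝔄 : σStructure} {k m} {ρ : Fin k → Fin (σStructure.dom 𝔄)}
         {η : Fin m → Fin (σStructure.dom 𝔄) → Bool} {φ : Formula k m} {A : Set} where

  ¬̇-expresses : Expresses 𝔄 ρ η φ A → Expresses 𝔄 ρ η (¬̇ φ) (¬ A)
  ¬̇-expresses φ≈A = expresses (¬-cong-⇔ (sat⇔ φ≈A))

  expresses-⇔ : {B : Set} → Expresses 𝔄 ρ η φ A → A ⇔ B → Expresses 𝔄 ρ η φ B
  expresses-⇔ φ≈A A⇔B = expresses (⇔.trans (sat⇔ φ≈A) A⇔B)

  module _ {ψ : Formula k m} {B : Set} where

    ∧̇-expresses : Expresses 𝔄 ρ η φ A → Expresses 𝔄 ρ η ψ B → Expresses 𝔄 ρ η (φ ∧̇ ψ) (A × B)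
    ∧̇-expresses φ≈A ψ≈B = expresses (sat⇔ φ≈A ×-⇔ sat⇔ ψ≈B)

    ⇒̇-expresses : Expresses 𝔄 ρ η φ A → Expresses 𝔄 ρ η ψ B → Expresses 𝔄 ρ η (φ ⇒̇ ψ) (A → B)
    ⇒̇-expresses φ≈A ψ≈B = expresses (→-cong-⇔ (sat⇔ φ≈A) (sat⇔ ψ≈B))

⋀ᵇ-expresses : {𝔄 : σStructure} {ρ : Fin k → Fin (σStructure.dom 𝔄)} {η : Fin m → Fin (σStructure.dom 𝔄) → Bool}
               {φ : BodyKind → Formula k m} {A : BodyKind → Set} →
               (∀ c → Expresses 𝔄 ρ η (φ c) (A c)) → Expresses 𝔄 ρ η (⋀ᵇ φ) (∀ c → A c)
⋀ᵇ-expresses {𝔄 = 𝔄} {ρ} {η} {φ} φ≈A =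
  expresses (⇔.trans (mk⇔ each (λ f → f kε , f k¬ , f knot , f knot¬ , f k¬not , f k¬not¬))
                     (Π-cong-⇔ (sat⇔ ∘ φ≈A)))
  where
  each : Sat 𝔄 ρ η (⋀ᵇ φ) → ∀ c → Sat 𝔄 ρ η (φ c)
  each (sε , _)                     kε     = sε
  each (_ , s¬ , _)                 k¬     = s¬
  each (_ , _ , snot , _)           knot   = snot
  each (_ , _ , _ , snot¬ , _)      knot¬  = snot¬
  each (_ , _ , _ , _ , s¬not , _)  k¬not  = s¬not
  each (_ , _ , _ , _ , _ , s¬not¬) k¬not¬ = s¬not¬

module _ (Π : ELP) where
  open ELP Π

  private
    D : Set
    D = Fin (nA + nR)

    U : USym → D → Set
    U = σStructure.uRel (𝔓 Π)

    B : BSym → D → D → Set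
    B = σStructure.bRel (𝔓 Π)

    body : Fin nR → List (BodyElem nA)
    body r = ERule.body (rules r)

    head : Fin nR → List (Fin nA)
    head r = ERule.head (rules r)

    variable
      ρ : Fin k → D
      η : Fin m → D → Bool
      v : Fin k
      P N M M′ P′ N′ : Fin m
      x : D
      a : Fin nA
      r : Fin nR
      Mi Mi′ : Interp nA
      I J : CWI nA

  Expresses𝔓 : (Fin k → D) → (Fin m → D → Bool) → Formula k m → Set → Set
  Expresses𝔓 = Expresses (𝔓 Π)

  atom : Fin nA → D
  atom a = a ↑ˡ nR

  rule : Fin nR → D
  rule r = nA ↑ʳ r

  IsAtom : D → Fin nA → Set
  IsAtom x a = splitAt nA x ≡ inj₁ a

  IsRule : D → Fin nR → Set
  IsRule x r = splitAt nA x ≡ inj₂ r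

  isAtom-atom : ∀ a → IsAtom (atom a) a
  isAtom-atom a = splitAt-↑ˡ nA a nR

  isRule-rule : ∀ r → IsRule (rule r) r
  isRule-rule r = splitAt-↑ʳ nA nR r

  isAtom⇒≡atom : IsAtom x a → atom a ≡ x
  isAtom⇒≡atom {x = x} x≡a = trans (cong (join nA nR) (sym x≡a)) (join-splitAt nA nR x)

  data Element (x : D) : Set where
    atom-elem : IsAtom x a → Element x
    rule-elem : IsRule x r → Element x

  element : ∀ x → Element x
  element x with splitAt nA x in x≡
  ... | inj₁ _ = atom-elem x≡
  ... | inj₂ _ = rule-elem x≡

  U-atom : IsAtom x a → U atomS x
  U-atom x≡a rewrite x≡a = tt

  U-rule : IsRule x r → U ruleS x
  U-rule x≡r rewrite x≡r = tt

  ¬U-atom : IsRule x r → ¬ U atomS x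
  ¬U-atom x≡r rewrite x≡r = id

  ¬U-rule : IsAtom x a → ¬ U ruleS x
  ¬U-rule x≡a rewrite x≡a = id

  B-body : ∀ c {y} → IsAtom x a → IsRule y r → B (bodySym c) x y ⇔ (bodyElem c a ∈ body r)
  B-body kε     x≡a y≡r rewrite x≡a | y≡r = ⇔.refl
  B-body k¬     x≡a y≡r rewrite x≡a | y≡r = ⇔.refl
  B-body knot   x≡a y≡r rewrite x≡a | y≡r = ⇔.refl
  B-body knot¬  x≡a y≡r rewrite x≡a | y≡r = ⇔.refl
  B-body k¬not  x≡a y≡r rewrite x≡a | y≡r = ⇔.refl
  B-body k¬not¬ x≡a y≡r rewrite x≡a | y≡r = ⇔.refl

  B-head : ∀ {y} → IsAtom x a → IsRule y r → B hS x y ⇔ (a ∈ head r)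
  B-head x≡a y≡r rewrite x≡a | y≡r = ⇔.refl

  ¬B-rule : ∀ s {y} → IsRule x r → ¬ B s x y
  ¬B-rule hS      x≡r rewrite x≡r = id
  ¬B-rule bS      x≡r rewrite x≡r = id
  ¬B-rule b¬S     x≡r rewrite x≡r = id
  ¬B-rule bnotS   x≡r rewrite x≡r = id
  ¬B-rule bnot¬S  x≡r rewrite x≡r = id
  ¬B-rule b¬notS  x≡r rewrite x≡r = id
  ¬B-rule b¬not¬S x≡r rewrite x≡r = id

  ∀ᵃ-expresses : {φ : Formula (suc k) m} {G : Fin nA → Set} →
                 (∀ {x a} → IsAtom x a → Expresses𝔓 (extend x ρ) η φ (G a)) →
                 Expresses𝔓 ρ η (∀ᵃ φ) (∀ a → G a)
  ∀ᵃ-expresses {ρ = ρ} {η = η} {φ = φ} {G} φ≈G = expresses (mk⇔ to′ from′)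
    where
    to′ : Sat (𝔓 Π) ρ η (∀ᵃ φ) → ∀ a → G a
    to′ f a = to (sat⇔ (φ≈G (isAtom-atom a))) (f (atom a) (U-atom (isAtom-atom a)))
    from′ : (∀ a → G a) → Sat (𝔓 Π) ρ η (∀ᵃ φ)
    from′ g x x∈A with element x
    ... | atom-elem x≡a = from (sat⇔ (φ≈G x≡a)) (g _)
    ... | rule-elem x≡r = ⊥-elim (¬U-atom x≡r x∈A)

  ∃ᵃ-expresses : {φ : Formula (suc k) m} {G : Fin nA → Set} →
                 (∀ {x a} → IsAtom x a → Expresses𝔓 (extend x ρ) η φ (G a)) →
                 Expresses𝔓 ρ η (∃ᵃ φ) (∃ G)
  ∃ᵃ-expresses {ρ = ρ} {η = η} {φ = φ} {G} φ≈G = expresses (mk⇔ to′ from′)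
    where
    to′ : Sat (𝔓 Π) ρ η (∃ᵃ φ) → ∃ G
    to′ (x , x∈A , s) with element x
    ... | atom-elem x≡a = _ , to (sat⇔ (φ≈G x≡a)) s
    ... | rule-elem x≡r = ⊥-elim (¬U-atom x≡r x∈A)
    from′ : ∃ G → Sat (𝔓 Π) ρ η (∃ᵃ φ)
    from′ (a , g) = atom a , U-atom (isAtom-atom a) , from (sat⇔ (φ≈G (isAtom-atom a))) g

  ∀ʳ-expresses : {φ : Formula (suc k) m} {G : Fin nR → Set} →
                 (∀ {x r} → IsRule x r → Expresses𝔓 (extend x ρ) η φ (G r)) →
                 Expresses𝔓 ρ η (∀ʳ φ) (∀ r → G r)
  ∀ʳ-expresses {ρ = ρ} {η = η} {φ = φ} {G} φ≈G = expresses (mk⇔ to′ from′)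
    where
    to′ : Sat (𝔓 Π) ρ η (∀ʳ φ) → ∀ r → G r
    to′ f r = to (sat⇔ (φ≈G (isRule-rule r))) (f (rule r) (U-rule (isRule-rule r)))
    from′ : (∀ r → G r) → Sat (𝔓 Π) ρ η (∀ʳ φ)
    from′ g x x∈R with element x
    ... | atom-elem x≡a = ⊥-elim (¬U-rule x≡a x∈R)
    ... | rule-elem x≡r = from (sat⇔ (φ≈G x≡r)) (g _)

  ∀[]-expresses : ∀ c {φ : Formula (suc k) m} {G : Fin nA → Set} → IsRule (ρ v) r →
                  (∀ {x a} → IsAtom x a → Expresses𝔓 (extend x ρ) η φ (G a)) →
                  Expresses𝔓 ρ η (∀[ bodySym c ∙ v ] φ) (∀ a → bodyElem c a ∈ body r → G a)
  ∀[]-expresses {ρ = ρ} {v = v} {r = r} {η = η} c {φ} {G} v≡r φ≈G = expresses (mk⇔ to′ from′)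
    where
    to′ : Sat (𝔓 Π) ρ η (∀[ bodySym c ∙ v ] φ) → ∀ a → bodyElem c a ∈ body r → G a
    to′ f a e∈ = to (sat⇔ (φ≈G (isAtom-atom a))) (f (atom a) (from (B-body c (isAtom-atom a) v≡r) e∈))
    from′ : (∀ a → bodyElem c a ∈ body r → G a) → Sat (𝔓 Π) ρ η (∀[ bodySym c ∙ v ] φ)
    from′ g x xBv with element x
    ... | atom-elem x≡a = from (sat⇔ (φ≈G x≡a)) (g _ (to (B-body c x≡a v≡r) xBv))
    ... | rule-elem x≡r = ⊥-elim (¬B-rule (bodySym c) x≡r xBv)

  bodyF-expresses : {φ : BodyKind → Formula (suc k) m} {R : PElem nA → Set} {f : BodyElem nA → PElem nA} →
                    IsRule (ρ v) r →
                    (∀ c {x a} → IsAtom x a → Expresses𝔓 (extend x ρ) η (φ c) (R (f (bodyElem c a)))) →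
                    Expresses𝔓 ρ η (bodyF φ v) (All R (map f (body r)))
  bodyF-expresses {r = r} {R = R} {f} v≡r φ≈R =
    expresses-⇔ (⋀ᵇ-expresses λ c → ∀[]-expresses c v≡r (φ≈R c))
                (⇔.trans (∀-bodyElem {R = λ e → e ∈ body r → R (f e)}) (⇔.sym All-map⇔))

  Represents : Interp nA → (D → Bool) → Set
  Represents M X = ∀ {x a} → IsAtom x a → M a ≡ X x

  ∈̇-expresses : Represents Mi (η M) → IsAtom (ρ v) a → Expresses𝔓 ρ η (v ∈̇ M) (Mi a ≡ true)
  ∈̇-expresses Mi≈M v≡a = expresses (≡true-cong (sym (Mi≈M v≡a)))

  ∉̇-expresses : Represents Mi (η M) → IsAtom (ρ v) a → Expresses𝔓 ρ η (¬̇ (v ∈̇ M)) (Mi a ≡ false)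
  ∉̇-expresses Mi≈M v≡a = expresses-⇔ (¬̇-expresses (∈̇-expresses Mi≈M v≡a)) ≢true⇔≡false

  headF-expresses : IsRule (ρ v) r → Represents Mi (η M) →
                    Expresses𝔓 ρ η (headF M v) (Any (λ a → Mi a ≡ true) (head r))
  headF-expresses {ρ = ρ} {v = v} {r = r} {Mi = Mi} {η = η} {M = M} v≡r Mi≈M = expresses (mk⇔ to′ from′)
    where
    to′ : Sat (𝔓 Π) ρ η (headF M v) → Any (λ a → Mi a ≡ true) (head r)
    to′ (x , xHv , x∈M) with element x
    ... | atom-elem x≡a = lose (to (B-head x≡a v≡r) xHv) (trans (Mi≈M x≡a) x∈M)
    ... | rule-elem x≡r = ⊥-elim (¬B-rule hS x≡r xHv)
    from′ : Any (λ a → Mi a ≡ true) (head r) → Sat (𝔓 Π) ρ η (headF M v)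
    from′ a∈H with find a∈H
    ... | a , a∈ , Mia = atom a , from (B-head (isAtom-atom a) v≡r) a∈ , trans (sym (Mi≈M (isAtom-atom a))) Mia

  encode : Interp nA → D → Bool
  encode M x = [ M , (λ _ → false) ]′ (splitAt nA x)

  restrict : (D → Bool) → Interp nA
  restrict X a = X (atom a)

  encode-represents : ∀ M → Represents M (encode M)
  encode-represents M x≡a rewrite x≡a = refl

  restrict-represents : ∀ X → Represents (restrict X) X
  restrict-represents X x≡a = cong X (isAtom⇒≡atom x≡a)

  Encodes : CWI nA → (D → Bool) → (D → Bool) → Set
  Encodes I X Y = ∀ {x a} → IsAtom x a → Code (I a) (X x) (Y x)

  Disjoint : (D → Bool) → (D → Bool) → Set
  Disjoint X Y = ∀ x → ¬ (X x ≡ true × Y x ≡ true)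

  encodeᴾ encodeᴺ : CWI nA → D → Bool
  encodeᴾ I = encode (inP ∘ I)
  encodeᴺ I = encode (inN ∘ I)

  restrictᶜ : (D → Bool) → (D → Bool) → CWI nA
  restrictᶜ X Y a = three (X (atom a)) (Y (atom a))

  encode-encodes : ∀ I → Encodes I (encodeᴾ I) (encodeᴺ I)
  encode-encodes I {a = a} x≡a =
    subst₂ (Code (I a)) (encode-represents (inP ∘ I) x≡a) (encode-represents (inN ∘ I) x≡a) (code (I a))

  encode-disjoint : ∀ I → Disjoint (encodeᴾ I) (encodeᴺ I)
  encode-disjoint I x with splitAt nA x
  ... | inj₁ a = code-disjoint (code (I a))
  ... | inj₂ _ = λ { (() , _) }

  restrictᶜ-encodes : ∀ {X Y} → Disjoint X Y → Encodes (restrictᶜ X Y) X Y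
  restrictᶜ-encodes {X} {Y} X∩Y=∅ {a = a} x≡a =
    subst (λ y → Code (restrictᶜ X Y a) (X y) (Y y)) (isAtom⇒≡atom x≡a)
          (code-three (X (atom a)) (Y (atom a)) (X∩Y=∅ (atom a)))

  ∀₂-expresses : {φ : Formula k (suc m)} {G : Interp nA → Set} →
                 (∀ {X M} → Represents M X → Expresses𝔓 ρ (extend X η) φ (G M)) →
                 Expresses𝔓 ρ η (∀₂ φ) (∀ M → G M)
  ∀₂-expresses φ≈G =
    expresses (mk⇔ (λ f M → to (sat⇔ (φ≈G (encode-represents M))) (f (encode M)))
                   (λ g X → from (sat⇔ (φ≈G (restrict-represents X))) (g (restrict X))))

  ∃₂-expresses : {φ : Formula k (suc m)} {G : Interp nA → Set} →
                 (∀ {X M} → Represents M X → Expresses𝔓 ρ (extend X η) φ (G M)) →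
                 Expresses𝔓 ρ η (∃₂ φ) (∃ G)
  ∃₂-expresses φ≈G =
    expresses (mk⇔ (λ (X , s) → restrict X , to (sat⇔ (φ≈G (restrict-represents X))) s)
                   (λ (M , g) → encode M , from (sat⇔ (φ≈G (encode-represents M))) g))

  ∀ᶜ-expresses : {φ : Formula k (suc (suc m))} {G : CWI nA → Set} →
                 (∀ {X Y I} → Encodes I X Y → Expresses𝔓 ρ (extend Y (extend X η)) φ (G I)) →
                 Expresses𝔓 ρ η (∀ᶜ φ) (∀ I → G I)
  ∀ᶜ-expresses φ≈G =
    expresses (mk⇔ (λ f I → to (sat⇔ (φ≈G (encode-encodes I))) (f (encodeᴾ I) (encodeᴺ I) (encode-disjoint I)))
                   (λ g X Y X∩Y=∅ → from (sat⇔ (φ≈G (restrictᶜ-encodes X∩Y=∅))) (g (restrictᶜ X Y))))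

  ∃ᶜ-expresses : {φ : Formula k (suc (suc m))} {G : CWI nA → Set} →
                 (∀ {X Y I} → Encodes I X Y → Expresses𝔓 ρ (extend Y (extend X η)) φ (G I)) →
                 Expresses𝔓 ρ η (∃ᶜ φ) (∃ G)
  ∃ᶜ-expresses φ≈G =
    expresses (mk⇔ (λ (X , Y , X∩Y=∅ , s) → restrictᶜ X Y , to (sat⇔ (φ≈G (restrictᶜ-encodes X∩Y=∅))) s)
                   (λ (I , g) → encodeᴾ I , encodeᴺ I , encode-disjoint I , from (sat⇔ (φ≈G (encode-encodes I))) g))

  ⊊F-expresses : Represents Mi′ (η M′) → Represents Mi (η M) → Expresses𝔓 ρ η (⊊F M′ M) (Mi′ ⊊ Mi)
  ⊊F-expresses Mi′≈M′ Mi≈M =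
    ∧̇-expresses (∀ᵃ-expresses λ x≡a → ⇒̇-expresses (∈̇-expresses Mi′≈M′ x≡a) (∈̇-expresses Mi≈M x≡a))
                (∃ᵃ-expresses λ x≡a → ∧̇-expresses (∈̇-expresses Mi≈M x≡a) (∉̇-expresses Mi′≈M′ x≡a))

  ⊊ᶜF-expresses : Encodes J (η P′) (η N′) → Encodes I (η P) (η N) → Expresses𝔓 ρ η (⊊ᶜF P′ N′ P N) (J ⊊ᴵ I)
  ⊊ᶜF-expresses J≈ I≈ =
    ∧̇-expresses (∀ᵃ-expresses λ x≡a → expresses (code-⊑ (J≈ x≡a) (I≈ x≡a)))
                (∃ᵃ-expresses λ x≡a → expresses (¬-cong-⇔ (code-≡ (J≈ x≡a) (I≈ x≡a))))

  module _ {I : CWI nA} where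

    atm-reductElem : ∀ e → atm a ≡ reductElem I e → e ≡ b-ε a
    atm-reductElem (b-ε _) refl = refl
    atm-reductElem (b-¬ _) ()
    atm-reductElem (b-not a′) eq with I a′ | eq
    ... | tP | () ; ... | tN | () ; ... | tU | ()
    atm-reductElem (b-not¬ a′) eq with I a′ | eq
    ... | tP | () ; ... | tN | () ; ... | tU | ()
    atm-reductElem (b-¬not a′) eq with I a′ | eq
    ... | tP | () ; ... | tN | () ; ... | tU | ()
    atm-reductElem (b-¬not¬ a′) eq with I a′ | eq
    ... | tP | () ; ... | tN | () ; ... | tU | ()

    atm∈reduct⇔ : ∀ {xs} → atm a ∈ map (reductElem I) xs ⇔ b-ε a ∈ xs
    atm∈reduct⇔ {xs = xs} = mk⇔ to′ (∈-map⁺ (reductElem I))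
      where
      to′ : atm a ∈ map (reductElem I) xs → b-ε a ∈ xs
      to′ a∈ with ∈-map⁻ (reductElem I) a∈
      ... | e , e∈ , a≡e = subst (_∈ xs) (atm-reductElem e a≡e) e∈

  keepOK⇔⊨E : ∀ e → (∀ a → atm a ≢ e) → KeepOK Mi e ⇔ (Mi ⊨E e)
  keepOK⇔⊨E (atm a)  e≢atm = ⊥-elim (e≢atm a refl)
  keepOK⇔⊨E (nlit _) _     = ⇔.refl
  keepOK⇔⊨E top      _     = ⇔.refl
  keepOK⇔⊨E ntop     _     = ⇔.refl

  module _ {k m} {ρ : Fin k → D} {η : Fin m → D → Bool} {P N M : Fin m} {x : D} {a : Fin nA}
           {Mi : Interp nA} {I : CWI nA} where

    sat-elemF : ∀ c → Code (I a) (η P x) (η N x) → Mi a ≡ η M x →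
                Sat (𝔓 Π) (extend x ρ) η (elemF P N M c) ⇔ (Mi ⊨E reductElem I (bodyElem c a))
    sat-elemF kε _ Mia≡ = ≡true-cong (sym Mia≡)
    sat-elemF k¬ _ Mia≡ = ¬-cong-⇔ (≡true-cong (sym Mia≡))
    sat-elemF knot cd Mia≡ with I a | η P x | η N x | η M x | cd | Mia≡
    ... | tP | _ | _ | _ | tP-code | refl = mk⇔ (λ f → f refl) (λ g _ → g)
    ... | tN | _ | _ | _ | tN-code | refl = mk⇔ (λ _ → tt) (λ _ ())
    ... | tU | _ | _ | _ | tU-code | refl = mk⇔ (λ _ → tt) (λ _ ())
    sat-elemF knot¬ cd Mia≡ with I a | η P x | η N x | η M x | cd | Mia≡
    ... | tP | _ | _ | _ | tP-code | refl = mk⇔ (λ _ → tt) (λ _ ())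
    ... | tN | _ | _ | _ | tN-code | refl = mk⇔ (λ f → f refl) (λ g _ → g)
    ... | tU | _ | _ | _ | tU-code | refl = mk⇔ (λ _ → tt) (λ _ ())
    sat-elemF k¬not cd Mia≡ with I a | η P x | η N x | η M x | cd | Mia≡
    ... | tP | _ | _ | _ | tP-code | refl = mk⇔ proj₂ (refl ,_)
    ... | tN | _ | _ | _ | tN-code | refl = mk⇔ (λ ()) (λ ¬⊤ → ⊥-elim (¬⊤ tt))
    ... | tU | _ | _ | _ | tU-code | refl = mk⇔ (λ ()) (λ ¬⊤ → ⊥-elim (¬⊤ tt))
    sat-elemF k¬not¬ cd Mia≡ with I a | η P x | η N x | η M x | cd | Mia≡
    ... | tP | _ | _ | _ | tP-code | refl = mk⇔ (λ ()) (λ ¬⊤ → ⊥-elim (¬⊤ tt))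
    ... | tN | _ | _ | _ | tN-code | refl = mk⇔ proj₂ (refl ,_)
    ... | tU | _ | _ | _ | tU-code | refl = mk⇔ (λ ()) (λ ¬⊤ → ⊥-elim (¬⊤ tt))

    elemF-expresses : ∀ c → Code (I a) (η P x) (η N x) → Mi a ≡ η M x →
                      Expresses𝔓 (extend x ρ) η (elemF P N M c) (Mi ⊨E reductElem I (bodyElem c a))
    elemF-expresses c cd Mia≡ = expresses (sat-elemF c cd Mia≡)

    elemF-expresses-keepOK : ∀ c → (∀ {a′} → bodyElem c a ≢ b-ε a′) →
                             Code (I a) (η P x) (η N x) → Mi a ≡ η M x →
                             Expresses𝔓 (extend x ρ) η (elemF P N M c) (KeepOK Mi (reductElem I (bodyElem c a)))
    elemF-expresses-keepOK c c≢ε cd Mia≡ =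
      expresses-⇔ (elemF-expresses c cd Mia≡) (⇔.sym (keepOK⇔⊨E _ λ _ eq → c≢ε (atm-reductElem _ eq)))

    keptF-expresses : ∀ c → Code (I a) (η P x) (η N x) → Mi a ≡ η M x →
                      Expresses𝔓 (extend x ρ) η (keptF P N M c) (KeepOK Mi (reductElem I (bodyElem c a)))
    keptF-expresses kε     _ _ = expresses (mk⇔ (λ _ → tt) (λ _ ()))
    keptF-expresses k¬     = elemF-expresses-keepOK k¬ (λ ())
    keptF-expresses knot   = elemF-expresses-keepOK knot (λ ())
    keptF-expresses knot¬  = elemF-expresses-keepOK knot¬ (λ ())
    keptF-expresses k¬not  = elemF-expresses-keepOK k¬not (λ ())
    keptF-expresses k¬not¬ = elemF-expresses-keepOK k¬not¬ (λ ())

  positiveBodyF-expresses : IsRule (ρ v) r → Represents Mi′ (η M′) →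
                            Expresses𝔓 ρ η (positiveBodyF M′ v)
                              (∀ a → BodyPos (map (reductElem I) (body r)) a → Mi′ a ≡ true)
  positiveBodyF-expresses v≡r Mi′≈M′ =
    expresses-⇔ (∀[]-expresses kε v≡r (∈̇-expresses Mi′≈M′))
                (Π-cong-⇔ λ _ → →-cong-⇔ (⇔.sym atm∈reduct⇔) ⇔.refl)

  modelF-expresses : Encodes I (η P) (η N) → Represents Mi (η M) →
                     Expresses𝔓 ρ η (modelF P N M) (Model Mi (epiReduct Π I))
  modelF-expresses I≈ Mi≈M = ∀ʳ-expresses λ x≡r →
    ⇒̇-expresses (bodyF-expresses x≡r λ c x≡a → elemF-expresses c (I≈ x≡a) (Mi≈M x≡a))
                (headF-expresses x≡r Mi≈M)

  reductModelF-expresses : Encodes I (η P) (η N) → Represents Mi (η M) → Represents Mi′ (η M′) →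
                           Expresses𝔓 ρ η (reductModelF P N M M′) (ModelReduct (epiReduct Π I) Mi Mi′)
  reductModelF-expresses I≈ Mi≈M Mi′≈M′ = ∀ʳ-expresses λ x≡r →
    ⇒̇-expresses (bodyF-expresses x≡r λ c x≡a → keptF-expresses c (I≈ x≡a) (Mi≈M x≡a))
                (⇒̇-expresses (positiveBodyF-expresses x≡r Mi′≈M′) (headF-expresses x≡r Mi′≈M′))

  answerSetF-expresses : Encodes I (η P) (η N) → Represents Mi (η M) →
                         Expresses𝔓 ρ η (answerSetF P N M) (AnswerSet (epiReduct Π I) Mi)
  answerSetF-expresses I≈ Mi≈M =
    ∧̇-expresses (modelF-expresses I≈ Mi≈M)
                (∀₂-expresses λ Mi′≈M′ → ⇒̇-expresses (⊊F-expresses Mi′≈M′ Mi≈M)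
                                                      (¬̇-expresses (reductModelF-expresses I≈ Mi≈M Mi′≈M′)))

  someAnswerSetF-expresses : Encodes I (η P) (η N) →
                             Expresses𝔓 ρ η (someAnswerSetF P N) (∃ (AnswerSet (epiReduct Π I)))
  someAnswerSetF-expresses I≈ = ∃₂-expresses (answerSetF-expresses I≈)

  positiveF-expresses : Encodes I (η P) (η N) →
                        Expresses𝔓 ρ η (positiveF P N)
                          (∀ a → I a ≡ tP → ∀ J → AnswerSet (epiReduct Π I) J → J a ≡ true)
  positiveF-expresses I≈ = ∀ᵃ-expresses λ x≡a →
    ⇒̇-expresses (expresses (code-tP (I≈ x≡a)))
                (∀₂-expresses λ J≈ → ⇒̇-expresses (answerSetF-expresses I≈ J≈) (∈̇-expresses J≈ x≡a))

  negativeF-expresses : Encodes I (η P) (η N) →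
                        Expresses𝔓 ρ η (negativeF P N)
                          (∀ a → I a ≡ tN → ∀ J → AnswerSet (epiReduct Π I) J → J a ≡ false)
  negativeF-expresses I≈ = ∀ᵃ-expresses λ x≡a →
    ⇒̇-expresses (expresses (code-tN (I≈ x≡a)))
                (∀₂-expresses λ J≈ → ⇒̇-expresses (answerSetF-expresses I≈ J≈) (∉̇-expresses J≈ x≡a))

  undefinedF-expresses : Encodes I (η P) (η N) →
                         Expresses𝔓 ρ η (undefinedF P N)
                           (∀ a → I a ≡ tU → ∃ λ J → ∃ λ J′ → AnswerSet (epiReduct Π I) J ×
                              AnswerSet (epiReduct Π I) J′ × J a ≡ true × J′ a ≡ false)
  undefinedF-expresses I≈ = ∀ᵃ-expresses λ x≡a →
    ⇒̇-expresses (expresses (code-tU (I≈ x≡a)))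
                (∃₂-expresses λ J≈ → ∃₂-expresses λ J′≈ →
                   ∧̇-expresses (answerSetF-expresses I≈ J≈)
                   (∧̇-expresses (answerSetF-expresses I≈ J′≈)
                   (∧̇-expresses (∈̇-expresses J≈ x≡a) (∉̇-expresses J′≈ x≡a))))

  candidateWorldViewF-expresses : Encodes I (η P) (η N) → Expresses𝔓 ρ η (candidateWorldViewF P N) (CWV Π I)
  candidateWorldViewF-expresses I≈ =
    ∧̇-expresses (someAnswerSetF-expresses I≈)
    (∧̇-expresses (positiveF-expresses I≈) (∧̇-expresses (negativeF-expresses I≈) (undefinedF-expresses I≈)))

  worldViewF-expresses : Encodes I (η P) (η N) → Expresses𝔓 ρ η (worldViewF P N) (WV Π I)
  worldViewF-expresses I≈ =
    ∧̇-expresses (candidateWorldViewF-expresses I≈)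
                (∀ᶜ-expresses λ J≈ → ⇒̇-expresses (⊊ᶜF-expresses J≈ I≈)
                                                 (¬̇-expresses (candidateWorldViewF-expresses J≈)))

  hasWorldViewF-expresses : Expresses𝔓 (λ ()) (λ ()) hasWorldViewF (HasWorldView Π)
  hasWorldViewF-expresses = ∃ᶜ-expresses worldViewF-expresses

lemma1 : Σ Sentence λ φ → (Π : ELP) → HasWorldView Π ⇔ (𝔓 Π ⊨ φ)
lemma1 = hasWorldViewF , λ Π → ⇔.sym (sat⇔ (hasWorldViewF-expresses Π))
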